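{- In constructive mathematics, the statement "for any two ordered sets $X$ and $Y$, the lexicographic order on the cartesian product $X\times Y$ is cotransitive" implies the law of excluded middle.
   Context: The setting is constructive mathematics: no use of the law of excluded middle. An ordered set is a set $X$ with a binary relation $<$ such that for all $x,y,z\in X$: (1) $x<y$ implies $\neg(y<x)$; (2) $x<y$ implies $x<z$ or $z<y$ (cotransitivity); (3) $\neg(x<y)$ and $\neg(y<x)$ imply $x=y$. The cartesian product $X\times Y$ has equality $(x,y)=(x',y')$ iff $x=x'$ and $y=y'$. The lexicographic order on it is $(x,y)<(x',y')$ iff $x<x'$, or ($x=x'$ and $y<y'$). A relation $<$ is cotransitive if $a<b$ implies $a<c$ or $c<b$ for all $a,b,c$. -}

module Defs where

open import Level using (Level; suc; _⊔_)
open import Data.Product using (_×_; _,_; proj₁; proj₂)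
open import Data.Sum using (_⊎_)
open import Relation.Nullary using (¬_)
open import Relation.Binary.PropositionalEquality using (_≡_)
open import Relation.Binary.Structures using (IsEquivalence)

-- A (Bishop) set is a type with an equivalence relation _≈_ as its equality.
record OrderedSet (ℓ : Level) : Set (suc ℓ) where
  field
    Carrier       : Set ℓ
    _≈_           : Carrier → Carrier → Set ℓ
    _<_           : Carrier → Carrier → Set ℓ
    isEquivalence : IsEquivalence _≈_
    <-resp-≈      : ∀ {x x′ y y′} → x ≈ x′ → y ≈ y′ → x < y → x′ < y′
    asym          : ∀ {x y} → x < y → ¬ (y < x)
    cotrans       : ∀ {x y} z → x < y → (x < z) ⊎ (z < y)
    tight         : ∀ {x y} → ¬ (x < y) → ¬ (y < x) → x ≈ y

module _ {ℓ : Level} (X Y : OrderedSet ℓ) where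
  private
    module X = OrderedSet X
    module Y = OrderedSet Y

  LexCarrier : Set ℓ
  LexCarrier = X.Carrier × Y.Carrier

  _<lex_ : LexCarrier → LexCarrier → Set ℓ
  (x , y) <lex (x′ , y′) = (x X.< x′) ⊎ ((x X.≈ x′) × (y Y.< y′))

Cotransitive : ∀ {a ℓ} {A : Set a} → (A → A → Set ℓ) → Set (a ⊔ ℓ)
Cotransitive _<_ = ∀ a b c → a < b → (a < c) ⊎ (c < b)

IsProp : ∀ {ℓ} → Set ℓ → Set ℓ
IsProp P = (p q : P) → p ≡ q

LEM : (ℓ : Level) → Set (suc ℓ)
LEM ℓ = (P : Set ℓ) → IsProp P → P ⊎ ¬ P

-- For any type P, the two points lo, hi with lo < hi iff P and lo = hi iff ¬ P form an
-- ordered set. If the lexicographic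
-- order on X × Y is cotransitive and y < y′ in Y, comparing (x, y) < (x, y′) with (x′, y)
-- makes X trichotomous; for the two-point set, trichotomy between lo and hi is P ⊎ ¬ P.
-- The required Y is the same construction with P = ⊤.
module Submission where

open import Defs
open import Level using (Level; Lift; lift)
open import Data.Product using (_,_)
open import Data.Sum using (_⊎_; inj₁; inj₂)
open import Data.Empty using (⊥; ⊥-elim)
open import Data.Unit using (⊤; tt)
open import Relation.Nullary using (¬_)
open import Relation.Binary.Structures using (IsEquivalence)

module _ {ℓ : Level} (X Y : OrderedSet ℓ) where
  private
    module X = OrderedSet X
    module Y = OrderedSet Y

  lex-cotransitive⇒trichotomous : Cotransitive (_<lex_ X Y) → ∀ {y y′} → y Y.< y′ →
    ∀ x x′ → x X.< x′ ⊎ x′ X.< x ⊎ x′ X.≈ x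
  lex-cotransitive⇒trichotomous cotrans {y} {y′} y<y′ x x′
    with cotrans (x , y) (x , y′) (x′ , y) (inj₂ (IsEquivalence.refl X.isEquivalence , y<y′))
  ... | inj₁ (inj₁ x<x′)       = inj₁ x<x′
  ... | inj₁ (inj₂ (_ , y<y))  = ⊥-elim (Y.asym y<y y<y)
  ... | inj₂ (inj₁ x′<x)       = inj₂ (inj₁ x′<x)
  ... | inj₂ (inj₂ (x′≈x , _)) = inj₂ (inj₂ x′≈x)

module TwoPoint {ℓ : Level} (P : Set ℓ) where

  data Two : Set ℓ where
    lo hi : Two

  _≈_ : Two → Two → Set ℓ
  lo ≈ lo = Lift ℓ ⊤
  hi ≈ hi = Lift ℓ ⊤
  lo ≈ hi = ¬ P
  hi ≈ lo = ¬ P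

  _<_ : Two → Two → Set ℓ
  lo < hi = P
  _  < _  = Lift ℓ ⊥

  ≈-refl : ∀ {x} → x ≈ x
  ≈-refl {lo} = lift tt
  ≈-refl {hi} = lift tt

  ≈-sym : ∀ {x y} → x ≈ y → y ≈ x
  ≈-sym {lo} {lo} e = e
  ≈-sym {lo} {hi} e = e
  ≈-sym {hi} {lo} e = e
  ≈-sym {hi} {hi} e = e

  ≈-trans : ∀ {x y z} → x ≈ y → y ≈ z → x ≈ z
  ≈-trans {lo} {lo} _ e = e
  ≈-trans {hi} {hi} _ e = e
  ≈-trans {lo} {hi} {lo} _ _ = lift tt
  ≈-trans {lo} {hi} {hi} e _ = e
  ≈-trans {hi} {lo} {lo} e _ = e
  ≈-trans {hi} {lo} {hi} _ _ = lift tt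

  <-resp-≈ : ∀ {x x′ y y′} → x ≈ x′ → y ≈ y′ → x < y → x′ < y′
  <-resp-≈ {lo} {lo} {hi} {hi} _ _ p = p
  <-resp-≈ {lo} {lo} {hi} {lo} _ hi≈lo p = ⊥-elim (hi≈lo p)
  <-resp-≈ {lo} {hi} {hi} lo≈hi _ p = ⊥-elim (lo≈hi p)
  <-resp-≈ {lo} {_} {lo} _ _ (lift ())
  <-resp-≈ {hi} _ _ (lift ())

  <-asym : ∀ {x y} → x < y → ¬ (y < x)
  <-asym {lo} {hi} _ (lift ())
  <-asym {lo} {lo} (lift ())
  <-asym {hi} (lift ())

  <-cotrans : ∀ {x y} z → x < y → (x < z) ⊎ (z < y)
  <-cotrans {lo} {hi} lo p = inj₂ p
  <-cotrans {lo} {hi} hi p = inj₁ p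
  <-cotrans {lo} {lo} _ (lift ())
  <-cotrans {hi} _ (lift ())

  <-tight : ∀ {x y} → ¬ (x < y) → ¬ (y < x) → x ≈ y
  <-tight {lo} {lo} _ _ = lift tt
  <-tight {hi} {hi} _ _ = lift tt
  <-tight {lo} {hi} ¬p _ = ¬p
  <-tight {hi} {lo} _ ¬p = ¬p

  orderedSet : OrderedSet ℓ
  orderedSet = record
    { Carrier       = Two
    ; _≈_           = _≈_
    ; _<_           = _<_
    ; isEquivalence = record { refl = ≈-refl ; sym = ≈-sym ; trans = ≈-trans }
    ; <-resp-≈      = <-resp-≈
    ; asym          = <-asym
    ; cotrans       = <-cotrans
    ; tight         = <-tight
    }

theorem17 : ∀ {ℓ : Level} →
    ((X Y : OrderedSet ℓ) → Cotransitive (_<lex_ X Y)) → LEM ℓ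
theorem17 {ℓ} lex-cotrans P _
  with lex-cotransitive⇒trichotomous X Y (lex-cotrans X Y) {lo} {hi} (lift tt) lo hi
  where
  open TwoPoint using (lo; hi)
  X Y : OrderedSet ℓ
  X = TwoPoint.orderedSet P
  Y = TwoPoint.orderedSet (Lift ℓ ⊤)
... | inj₁ p                = inj₁ p
... | inj₂ (inj₁ (lift ()))
... | inj₂ (inj₂ ¬p)        = inj₂ ¬p
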